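{- Let $\Gamma$ be a finite simple Cayley graph on $n$ vertices, and let $s$ be the order of the stabilizer of a vertex in $\mathrm{Aut}(\Gamma)$. Then $\Gamma$ is $k$-uniformly vertex-transitive for all $1\le k\le s$.
   Context: For a finite group $G$ and $S\subset G$, the Cayley graph $C(G,S)$ has vertex set $G$, with $a,b$ adjacent iff $a=sb$ or $b=sa$ for some $s\in S$; a graph is Cayley if isomorphic to some $C(G,S)$. Automorphisms are identified with $n\times n$ permutation matrices (entry $(u,v)$ is $1$ iff $\sigma(u)=v$); $J_n$ is the all-ones matrix. For an integer $k\ge1$, $\Gamma$ is $k$-uniformly vertex-transitive if there is a subset $\{\sigma_1,\ldots,\sigma_{kn}\}\subset\mathrm{Aut}(\Gamma)$ of size $kn$ with $\sum_i\sigma_i=kJ_n$. -}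

module Defs where

open import Data.Nat using (ℕ; zero; suc; _+_; _*_)
open import Data.Bool using (Bool; true; false)
open import Data.Fin using (Fin)
open import Data.Fin.Properties using (_≟_)
open import Data.Fin.Permutation using (Permutation′; _⟨$⟩ʳ_)
open import Data.List using (List; []; _∷_; length)
open import Data.List.Relation.Unary.All using (All)
open import Data.List.Relation.Unary.Any using (Any)
open import Data.List.Relation.Unary.AllPairs using (AllPairs)
open import Data.Product using (Σ; _×_; _,_; ∃)
open import Data.Sum using (_⊎_)
open import Relation.Binary.PropositionalEquality using (_≡_)
open import Relation.Nullary using (¬_; does)
open import Function.Bundles using (_⇔_)

record SimpleGraph (n : ℕ) : Set where
  field
    Adj   : Fin n → Fin n → Bool
    sym   : ∀ u v → Adj u v ≡ Adj v u
    irrefl : ∀ u → Adj u u ≡ false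
open SimpleGraph public

-- A finite group of order m, presented on the carrier Fin m
-- (every finite group is isomorphic to one of these).
record FinGroup (m : ℕ) : Set where
  field
    _·_     : Fin m → Fin m → Fin m
    e       : Fin m
    inv     : Fin m → Fin m
    assoc   : ∀ a b c → (a · b) · c ≡ a · (b · c)
    identityˡ : ∀ a → e · a ≡ a
    identityʳ : ∀ a → a · e ≡ a
    inverseˡ : ∀ a → inv a · a ≡ e
    inverseʳ : ∀ a → a · inv a ≡ e
open FinGroup public

CayleyAdj : ∀ {m} → FinGroup m → (Fin m → Bool) → Fin m → Fin m → Set
CayleyAdj G S a b =
  Σ (Fin _) λ s → (S s ≡ true) × ((a ≡ (G · s) b) ⊎ (b ≡ (G · s) a))

IsCayley : ∀ {n} → SimpleGraph n → Set
IsCayley {n} Γ =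
  Σ ℕ λ m → Σ (FinGroup m) λ G → Σ (Fin m → Bool) λ S →
  Σ (Fin n → Fin m) λ φ →
    ((∀ x y → φ x ≡ φ y → x ≡ y) × (∀ a → ∃ λ x → φ x ≡ a)) ×
    (∀ u v → (Adj Γ u v ≡ true) ⇔ CayleyAdj G S (φ u) (φ v))

record Aut {n : ℕ} (Γ : SimpleGraph n) : Set where
  field
    perm     : Permutation′ n
    preserves : ∀ u v → Adj Γ (perm ⟨$⟩ʳ u) (perm ⟨$⟩ʳ v) ≡ Adj Γ u v
open Aut public

app : ∀ {n} {Γ : SimpleGraph n} → Aut Γ → Fin n → Fin n
app σ u = perm σ ⟨$⟩ʳ u

_≈A_ : ∀ {n} {Γ : SimpleGraph n} → Aut Γ → Aut Γ → Set
σ ≈A τ = ∀ u → app σ u ≡ app τ u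

-- A list of pairwise distinct automorphisms (i.e. a finite subset of Aut Γ).
Distinct : ∀ {n} {Γ : SimpleGraph n} → List (Aut Γ) → Set
Distinct = AllPairs (λ σ τ → ¬ (σ ≈A τ))

StabilizerOrder : ∀ {n} (Γ : SimpleGraph n) → Fin n → ℕ → Set
StabilizerOrder Γ v s =
  Σ (List (Aut Γ)) λ L →
    (length L ≡ s) × Distinct L × All (λ σ → app σ v ≡ v) L ×
    (∀ (σ : Aut Γ) → app σ v ≡ v → Any (λ τ → σ ≈A τ) L)

permMatrix : ∀ {n} {Γ : SimpleGraph n} → Aut Γ → Fin n → Fin n → ℕ
permMatrix σ u v with does (app σ u ≟ v)
... | true  = 1
... | false = 0

matSum : ∀ {n} {Γ : SimpleGraph n} → List (Aut Γ) → Fin n → Fin n → ℕ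
matSum []      u v = 0
matSum (σ ∷ L) u v = permMatrix σ u v + matSum L u v

J : ∀ n → Fin n → Fin n → ℕ
J n u v = 1

UniformlyVT : ∀ {n} (Γ : SimpleGraph n) → ℕ → Set
UniformlyVT {n} Γ k =
  Σ (List (Aut Γ)) λ L →
    (length L ≡ k * n) × Distinct L × (∀ u v → matSum L u v ≡ k * J n u v)

module Submission where

-- Right translations x ↦ x·d of G are automorphisms of C(G,S), and
-- they form a sharply transitive family {ρ_w} of automorphisms: for every
-- pair of vertices y, x exactly one ρ_w maps y to x.  Hence for any
-- automorphism τ the "coset" ρτ = {ρ_w ∘ τ : w} has n elements whose
-- permutation matrices sum to J_n.  If τ, τ' fix a vertex v, then
-- ρ_w ∘ τ = ρ_w' ∘ τ' forces w = w' (evaluate at v) and then τ = τ'; so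
-- cosets of k distinct stabilizer elements are pairwise disjoint, and
-- their union is a set of kn automorphisms whose matrices sum to kJ_n.

open import Defs hiding (sym; _·_; e; inv; assoc; identityˡ; identityʳ; inverseˡ; inverseʳ)
open import Data.Nat using (ℕ; zero; suc; _+_; _*_; _≤_)
open import Data.Nat.Properties
  using (*-identityʳ; +-assoc; m≤n⇒m⊓n≡m; +-0-commutativeMonoid)
open import Data.Bool using (Bool; true; false; if_then_else_)
open import Data.Bool.Properties using (⇔→≡)
open import Data.Fin using (Fin; zero; suc; punchIn)
open import Data.Fin.Properties using (_≟_; punchInᵢ≢i)
open import Data.Fin.Permutation using (permutation; _∘ₚ_; _⟨$⟩ˡ_)
import Data.Fin.Permutation as Perm
open import Data.List using (List; []; _∷_; length; _++_; tabulate; concatMap; take)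
open import Data.List.Properties using (length-++; length-tabulate; length-take)
open import Data.List.Relation.Unary.All as All using (All; []; _∷_)
import Data.List.Relation.Unary.All.Properties as Allₚ
open import Data.List.Relation.Unary.AllPairs using ([]; _∷_)
import Data.List.Relation.Unary.AllPairs.Properties as AllPairsₚ
open import Data.Product using (_×_; _,_; proj₁; proj₂; ∃)
open import Data.Sum using (inj₁; inj₂)
open import Data.Empty using (⊥-elim)
open import Relation.Nullary using (¬_; yes; no; does)
open import Relation.Binary.PropositionalEquality
open import Function.Bundles using (_⇔_; mk⇔; Equivalence)
import Function.Properties.Equivalence as ⇔
open import Algebra.Properties.CommutativeMonoid.Sum +-0-commutativeMonoid
  using (sum-syntax; sum-remove; sum-cong-≗; sum-replicate-zero)

δ : ∀ {n} → Fin n → Fin n → ℕ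
δ a b = if does (a ≟ b) then 1 else 0

permMatrix-δ : ∀ {n} {Γ : SimpleGraph n} (σ : Aut Γ) u x →
               permMatrix σ u x ≡ δ (app σ u) x
permMatrix-δ σ u x with does (app σ u ≟ x)
... | true  = refl
... | false = refl

δ-≡ : ∀ {n} {a b : Fin n} → a ≡ b → δ a b ≡ 1
δ-≡ {a = a} {b} a≡b with a ≟ b
... | yes _   = refl
... | no a≢b = ⊥-elim (a≢b a≡b)

δ-≢ : ∀ {n} {a b : Fin n} → ¬ a ≡ b → δ a b ≡ 0
δ-≢ {a = a} {b} a≢b with a ≟ b
... | yes a≡b = ⊥-elim (a≢b a≡b)
... | no _    = refl

δ-cong : ∀ {n} {a b c d : Fin n} → (a ≡ b ⇔ c ≡ d) → δ a b ≡ δ c d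
δ-cong {a = a} {b} {c} {d} a≡b⇔c≡d with c ≟ d
... | yes c≡d = δ-≡ (Equivalence.from a≡b⇔c≡d c≡d)
... | no c≢d  = δ-≢ (λ a≡b → c≢d (Equivalence.to a≡b⇔c≡d a≡b))

∑-δ : ∀ {n} (c : Fin n) → ∑[ w < n ] δ w c ≡ 1
∑-δ {suc n} c = begin
  ∑[ w < suc n ] δ w c                      ≡⟨ sum-remove {i = c} (λ w → δ w c) ⟩
  δ c c + ∑[ j < n ] δ (punchIn c j) c      ≡⟨ cong₂ _+_ (δ-≡ {a = c} refl) off-c ⟩
  1 + 0                                     ∎
  where
  open ≡-Reasoning
  off-c : ∑[ j < n ] δ (punchIn c j) c ≡ 0
  off-c = trans (sum-cong-≗ (λ j → δ-≢ (punchInᵢ≢i c j))) (sum-replicate-zero n)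

matSum-++ : ∀ {n} {Γ : SimpleGraph n} (xs ys : List (Aut Γ)) u x →
            matSum (xs ++ ys) u x ≡ matSum xs u x + matSum ys u x
matSum-++ []       ys u x = refl
matSum-++ (σ ∷ xs) ys u x =
  trans (cong (permMatrix σ u x +_) (matSum-++ xs ys u x))
        (sym (+-assoc (permMatrix σ u x) _ _))

matSum-tabulate : ∀ {n k} {Γ : SimpleGraph n} (F : Fin k → Aut Γ) u x →
                  matSum (tabulate F) u x ≡ ∑[ w < k ] permMatrix (F w) u x
matSum-tabulate {k = zero}  F u x = refl
matSum-tabulate {k = suc k} F u x =
  cong (permMatrix (F zero) u x +_) (matSum-tabulate (λ w → F (suc w)) u x)

module _ {n : ℕ} {Γ : SimpleGraph n} where

  -- Composition of automorphisms: (σ ∘A τ) u = σ (τ u).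
  _∘A_ : Aut Γ → Aut Γ → Aut Γ
  σ ∘A τ = record
    { perm      = perm τ ∘ₚ perm σ
    ; preserves = λ u u' → trans (preserves σ _ _) (preserves τ u u')
    }

  app-injective : (σ : Aut Γ) {u u' : Fin n} → app σ u ≡ app σ u' → u ≡ u'
  app-injective σ p =
    trans (sym (Perm.inverseˡ (perm σ)))
          (trans (cong (perm σ ⟨$⟩ˡ_) p) (Perm.inverseˡ (perm σ)))

  Fixes : Fin n → Aut Γ → Set
  Fixes v τ = app τ v ≡ v

record SharplyTransitive {n : ℕ} (Γ : SimpleGraph n) : Set where
  field
    ρ        : Fin n → Aut Γ
    locate   : Fin n → Fin n → Fin n
    ρ-locate : ∀ y w x → (app (ρ w) y ≡ x) ⇔ (w ≡ locate y x)

module Cosets {n : ℕ} {Γ : SimpleGraph n} (R : SharplyTransitive Γ) where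
  open SharplyTransitive R

  ρ-separates : ∀ y {w w'} → app (ρ w) y ≡ app (ρ w') y → w ≡ w'
  ρ-separates y {w} {w'} p =
    trans (Equivalence.to (ρ-locate y w _) p)
          (sym (Equivalence.to (ρ-locate y w' _) refl))

  coset : Aut Γ → List (Aut Γ)
  coset τ = tabulate (λ w → ρ w ∘A τ)

  -- For fixed u, x exactly one w has ρ_w (τ u) = x, so ρτ sums to J_n.
  coset-sum : ∀ τ u x → matSum (coset τ) u x ≡ 1
  coset-sum τ u x = begin
    matSum (coset τ) u x                   ≡⟨ matSum-tabulate (λ w → ρ w ∘A τ) u x ⟩
    ∑[ w < n ] permMatrix (ρ w ∘A τ) u x   ≡⟨ sum-cong-≗ entry ⟩
    ∑[ w < n ] δ w (locate (app τ u) x)    ≡⟨ ∑-δ (locate (app τ u) x) ⟩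
    1                                      ∎
    where
    open ≡-Reasoning
    entry : ∀ w → permMatrix (ρ w ∘A τ) u x ≡ δ w (locate (app τ u) x)
    entry w = trans (permMatrix-δ (ρ w ∘A τ) u x) (δ-cong (ρ-locate (app τ u) w x))

  coset-≈ : ∀ {v τ τ'} w w' → Fixes v τ → Fixes v τ' →
            (ρ w ∘A τ) ≈A (ρ w' ∘A τ') → (w ≡ w') × (τ ≈A τ')
  coset-≈ {v} {τ} {τ'} w w' τv τ'v eq = w≡w' , λ u →
    app-injective (ρ w) (trans (eq u) (cong (λ z → app (ρ z) (app τ' u)) (sym w≡w')))
    where
    w≡w' : w ≡ w'
    w≡w' = ρ-separates v (subst₂ (λ a b → app (ρ w) a ≡ app (ρ w') b) τv τ'v (eq v))

  cosets : List (Aut Γ) → List (Aut Γ)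
  cosets = concatMap coset

  cosets-length : ∀ L → length (cosets L) ≡ length L * n
  cosets-length []      = refl
  cosets-length (τ ∷ L) =
    trans (length-++ (coset τ)) (cong₂ _+_ (length-tabulate _) (cosets-length L))

  cosets-sum : ∀ L u x → matSum (cosets L) u x ≡ length L
  cosets-sum []      u x = refl
  cosets-sum (τ ∷ L) u x =
    trans (matSum-++ (coset τ) _ u x) (cong₂ _+_ (coset-sum τ u x) (cosets-sum L u x))

  cosets-All : ∀ {P : Aut Γ → Set} L →
               All (λ τ → ∀ w → P (ρ w ∘A τ)) L → All P (cosets L)
  cosets-All []      []         = []
  cosets-All (τ ∷ L) (Pτ ∷ PL) =
    Allₚ.++⁺ (Allₚ.tabulate⁺ Pτ) (cosets-All L PL)

  cosets-distinct : ∀ {v} L → Distinct L → All (Fixes v) L → Distinct (cosets L)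
  cosets-distinct []      []        []        = []
  cosets-distinct {v} (τ ∷ L) (τ∉L ∷ dL) (τv ∷ Lv) =
    AllPairsₚ.++⁺ within (cosets-distinct L dL Lv)
      (Allₚ.tabulate⁺ λ w →
         cosets-All L (All.zipWith (λ {τ'} → across w {τ'}) (τ∉L , Lv)))
    where
    within : Distinct (coset τ)
    within = AllPairsₚ.tabulate⁺ λ {w} {w'} w≢w' eq →
      w≢w' (proj₁ (coset-≈ {τ = τ} {τ} w w' τv τv eq))
    across : ∀ w {τ'} → ¬ τ ≈A τ' × Fixes v τ' → ∀ w' → ¬ (ρ w ∘A τ) ≈A (ρ w' ∘A τ')
    across w {τ'} (τ≉τ' , τ'v) w' eq =
      τ≉τ' (proj₂ (coset-≈ {τ = τ} {τ'} w w' τv τ'v eq))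

uniformlyVT-from-stabilizer : ∀ {n} {Γ : SimpleGraph n} → SharplyTransitive Γ →
  ∀ v s → StabilizerOrder Γ v s → ∀ k → k ≤ s → UniformlyVT Γ k
uniformlyVT-from-stabilizer {n} R v s (L , |L|≡s , dL , Lv , _) k k≤s =
  cosets Lₖ ,
  trans (cosets-length Lₖ) (cong (_* n) |Lₖ|≡k) ,
  cosets-distinct Lₖ (AllPairsₚ.take⁺ k dL) (Allₚ.take⁺ k Lv) ,
  λ u x → trans (cosets-sum Lₖ u x) (trans |Lₖ|≡k (sym (*-identityʳ k)))
  where
  open Cosets R
  Lₖ : List _
  Lₖ = take k L
  |Lₖ|≡k : length Lₖ ≡ k
  |Lₖ|≡k = trans (length-take k L) (m≤n⇒m⊓n≡m (subst (k ≤_) (sym |L|≡s) k≤s))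

module GroupLemmas {m : ℕ} (G : FinGroup m) where
  open FinGroup G public using ()
    renaming (_·_ to infixl 7 _∙_; inv to infix 8 _⁻¹)
  open FinGroup G using (assoc; identityˡ; identityʳ)
    renaming (inverseˡ to ⁻¹-∙; inverseʳ to ∙-⁻¹)

  ∙-⁻¹-cancelʳ : ∀ x d → x ∙ d ∙ d ⁻¹ ≡ x
  ∙-⁻¹-cancelʳ x d = trans (assoc x d (d ⁻¹)) (trans (cong (x ∙_) (∙-⁻¹ d)) (identityʳ x))

  ⁻¹-∙-cancelʳ : ∀ x d → x ∙ d ⁻¹ ∙ d ≡ x
  ⁻¹-∙-cancelʳ x d = trans (assoc x (d ⁻¹) d) (trans (cong (x ∙_) (⁻¹-∙ d)) (identityʳ x))

  ∙-solveʳ : ∀ a b c → (a ∙ b ≡ c) ⇔ (b ≡ a ⁻¹ ∙ c)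
  ∙-solveʳ a b c = mk⇔
    (λ ab≡c → trans (sym ⁻¹-∙-cancelˡ) (cong (a ⁻¹ ∙_) ab≡c))
    (λ b≡a⁻¹c → trans (cong (a ∙_) b≡a⁻¹c) ∙-⁻¹-cancelˡ)
    where
    ⁻¹-∙-cancelˡ : a ⁻¹ ∙ (a ∙ b) ≡ b
    ⁻¹-∙-cancelˡ = trans (sym (assoc (a ⁻¹) a b)) (trans (cong (_∙ b) (⁻¹-∙ a)) (identityˡ b))
    ∙-⁻¹-cancelˡ : a ∙ (a ⁻¹ ∙ c) ≡ c
    ∙-⁻¹-cancelˡ = trans (sym (assoc a (a ⁻¹) c)) (trans (cong (_∙ c) (∙-⁻¹ a)) (identityˡ c))

  -- Right translation preserves Cayley adjacency, since adjacency is
  -- defined by left multiplication with elements of S.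
  CayleyAdj-translate : ∀ S x y d → CayleyAdj G S x y ⇔ CayleyAdj G S (x ∙ d) (y ∙ d)
  CayleyAdj-translate S x y d = mk⇔ (forward d)
    (λ adj → subst₂ (CayleyAdj G S) (∙-⁻¹-cancelʳ x d) (∙-⁻¹-cancelʳ y d)
                    (forward (d ⁻¹) adj))
    where
    forward : ∀ {x y} d → CayleyAdj G S x y → CayleyAdj G S (x ∙ d) (y ∙ d)
    forward {x} {y} d (s , s∈S , inj₁ x≡sy) =
      s , s∈S , inj₁ (trans (cong (_∙ d) x≡sy) (assoc s y d))
    forward {x} {y} d (s , s∈S , inj₂ y≡sx) =
      s , s∈S , inj₂ (trans (cong (_∙ d) y≡sx) (assoc s x d))

module CayleyTranslations {n m : ℕ} (Γ : SimpleGraph n) (G : FinGroup m)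
  (S : Fin m → Bool) (φ : Fin n → Fin m)
  (φ-injective : ∀ x y → φ x ≡ φ y → x ≡ y) (φ-surjective : ∀ a → ∃ λ x → φ x ≡ a)
  (φ-adj : ∀ u v → (Adj Γ u v ≡ true) ⇔ CayleyAdj G S (φ u) (φ v)) where
  open GroupLemmas G

  ψ : Fin m → Fin n
  ψ a = proj₁ (φ-surjective a)

  φψ : ∀ a → φ (ψ a) ≡ a
  φψ a = proj₂ (φ-surjective a)

  ψφ : ∀ u → ψ (φ u) ≡ u
  ψφ u = φ-injective _ _ (φψ (φ u))

  ψ-specˡ : ∀ a x → (ψ a ≡ x) ⇔ (a ≡ φ x)
  ψ-specˡ a x = mk⇔ (λ p → trans (sym (φψ a)) (cong φ p)) (λ q → trans (cong ψ q) (ψφ x))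

  ψ-specʳ : ∀ a x → (φ x ≡ a) ⇔ (x ≡ ψ a)
  ψ-specʳ a x = mk⇔ (λ p → trans (sym (ψφ x)) (cong ψ p)) (λ q → trans (cong φ q) (φψ a))

  shift : Fin m → Fin n → Fin n
  shift d u = ψ (φ u ∙ d)

  shift-shift : ∀ d d' u → (φ u ∙ d ∙ d' ≡ φ u) → shift d' (shift d u) ≡ u
  shift-shift d d' u cancels =
    trans (cong (λ a → ψ (a ∙ d')) (φψ _)) (trans (cong ψ cancels) (ψφ u))

  shift-preserves : ∀ d u u' → Adj Γ (shift d u) (shift d u') ≡ Adj Γ u u'
  shift-preserves d u u' = ⇔→≡ (⇔.trans
    (subst₂ (λ a b → (Adj Γ (shift d u) (shift d u') ≡ true) ⇔ CayleyAdj G S a b)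
            (φψ _) (φψ _) (φ-adj _ _))
    (⇔.trans (⇔.sym (CayleyAdj-translate S (φ u) (φ u') d)) (⇔.sym (φ-adj u u'))))

  translation : Fin m → Aut Γ
  translation d = record
    { perm      = permutation (shift d) (shift (d ⁻¹))
                    (λ u → shift-shift (d ⁻¹) d u (⁻¹-∙-cancelʳ (φ u) d))
                    (λ u → shift-shift d (d ⁻¹) u (∙-⁻¹-cancelʳ (φ u) d))
    ; preserves = shift-preserves d
    }

  -- ρ_w = translation by φ w; it maps y to x iff φ w = (φ y)⁻¹ ∙ φ x.
  sharplyTransitive : SharplyTransitive Γ
  sharplyTransitive = record
    { ρ        = λ w → translation (φ w)
    ; locate   = λ y x → ψ (φ y ⁻¹ ∙ φ x)
    ; ρ-locate = λ y w x → ⇔.trans (ψ-specˡ (φ y ∙ φ w) x)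
                   (⇔.trans (∙-solveʳ (φ y) (φ w) (φ x)) (ψ-specʳ _ w))
    }

-- (5) The theorem: right translations form a sharply transitive family.

proposition6p3 : ∀ (n : ℕ) (Γ : SimpleGraph n) → IsCayley Γ →
    ∀ (v : Fin n) (s : ℕ) → StabilizerOrder Γ v s →
    ∀ (k : ℕ) → 1 ≤ k → k ≤ s → UniformlyVT Γ k
proposition6p3 n Γ (m , G , S , φ , (φ-injective , φ-surjective) , φ-adj) v s stabilizer k _ k≤s =
  uniformlyVT-from-stabilizer translations v s stabilizer k k≤s
  where
  translations : SharplyTransitive Γ
  translations = CayleyTranslations.sharplyTransitive Γ G S φ φ-injective φ-surjective φ-adj
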